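{- Every finite connected bipartite graph $G$ admits a $2$-labelling $\ell$ such that, writing $S_x = \{v \in V(G) : \rho_\ell(v) = x\}$, there is at most one value $x$ for which $S_x$ is not an independent set, and for that value the induced subgraph $G[S_x]$ consists of at most one star together with isolated vertices.
   Context: A $2$-labelling of a graph $G$ is a map $\ell: E(G) \to \{1,2\}$. For a vertex $v$, $\rho_\ell(v)$ denotes the product of the labels $\ell(uv)$ over all edges $uv$ incident to $v$ (the empty product being $1$). -}

module Defs where

open import Data.Nat using (ℕ)
open import Data.Bool using (Bool; true; false; if_then_else_)
open import Data.Fin using (Fin)
open import Data.List using (map; allFin)
open import Data.Nat.ListAction using (product)
open import Data.Empty using (⊥)
open import Data.Product using (Σ; ∃; _×_)
open import Data.Sum using (_⊎_)
open import Relation.Binary.PropositionalEquality using (_≡_; _≢_)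
open import Relation.Binary.Construct.Closure.ReflexiveTransitive using (Star)

record Graph (n : ℕ) : Set where
  field
    adj     : Fin n → Fin n → Bool
    symm    : ∀ u v → adj u v ≡ adj v u
    irrefl  : ∀ v → adj v v ≡ false

open Graph public

Adj : {n : ℕ} → Graph n → Fin n → Fin n → Set
Adj G u v = adj G u v ≡ true

Connected : {n : ℕ} → Graph n → Set
Connected G = ∀ u v → Star (Adj G) u v

Bipartite : {n : ℕ} → Graph n → Set
Bipartite {n} G = Σ (Fin n → Bool) λ c → ∀ u v → Adj G u v → c u ≢ c v

-- a 2-labelling: a label in {1,2} on every edge (the label of edge uv is
-- ℓ u v = ℓ v u; values on non-edges are irrelevant)
Is2Labelling : {n : ℕ} → Graph n → (Fin n → Fin n → ℕ) → Set
Is2Labelling G ℓ = ∀ u v → Adj G u v → (ℓ u v ≡ ℓ v u) × (ℓ u v ≡ 1 ⊎ ℓ u v ≡ 2)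

ρ : {n : ℕ} → Graph n → (Fin n → Fin n → ℕ) → Fin n → ℕ
ρ {n} G ℓ v = product (map (λ u → if adj G v u then ℓ v u else 1) (allFin n))

S : {n : ℕ} → Graph n → (Fin n → Fin n → ℕ) → ℕ → Fin n → Set
S G ℓ x v = ρ G ℓ v ≡ x

Independent : {n : ℕ} → Graph n → (Fin n → Set) → Set
Independent G P = ∀ u v → P u → P v → Adj G u v → ⊥

StarPlusIsolated : {n : ℕ} → Graph n → (Fin n → Set) → Set
StarPlusIsolated {n} G P =
  Σ (Fin n) λ c → P c × (∀ u v → P u → P v → Adj G u v → u ≡ c ⊎ v ≡ c)

-- Work over GF(2) = Parity. Pick a root r and, for every vertex t of the colour
-- class 1 of the bipartition, a walk from r to t; let F be the set of edges used
-- an odd number of times by these walks. A walk from a to b has odd degree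
-- exactly at a and b (when a ≠ b), so every vertex x ≠ r has odd degree in F iff
-- x has colour 1. Labelling the edges of F by 2 and the others by 1 gives
-- ρ(x) = 2^(deg_F x), hence two adjacent vertices with equal products have
-- F-degrees of equal parity, hence equal colours unless one of them is r. So
-- every edge inside some S_x passes through r: there is only one such x, namely
-- ρ(r), and G[S_x] is a star centred at r plus isolated vertices.
module Submission where

open import Defs
open import Algebra.Properties.CommutativeSemigroup using (x∙yz≈y∙xz)
open import Algebra.Properties.Semiring.Sum as ℙ∑ using ()
open import Data.Bool using (Bool; true; false; if_then_else_)
open import Data.Empty using (⊥-elim)
open import Data.Fin using (Fin; zero; suc)
open import Data.Fin.Properties using (_≟_)
open import Data.List using (map; allFin; tabulate)
open import Data.List.Properties using (map-cong; map-tabulate)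
open import Data.Nat as ℕ using (ℕ; zero; suc; _^_; parity)
open import Data.Nat.ListAction using (product)
open import Data.Nat.Logarithm using (⌊log₂_⌋; ⌊log₂[2^n]⌋≡n)
import Data.Nat.Properties as ℕ
open import Data.Parity.Base using (Parity; 0ℙ; 1ℙ; _+_; _*_)
open import Data.Parity.Properties
  using (+-assoc; +-comm; *-comm; *-distribˡ-+; +-identityʳ; *-zeroʳ; p+p≡0ℙ;
         +-*-semiring; *-commutativeSemigroup; +-homo-+)
open import Data.Product using (Σ; Σ-syntax; _×_; _,_)
open import Data.Sum using (_⊎_; inj₁; inj₂)
open import Relation.Nullary using (¬_; yes; no; does)
open import Relation.Binary.PropositionalEquality
open import Relation.Binary.Construct.Closure.ReflexiveTransitive using (Star; ε; _◅_)

open ℙ∑ +-*-semiring using (sum-syntax; ∑-distrib-+; ∑-comm; *-distribˡ-sum; sum-cong-≗; sum-replicate-zero)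
module ℕ∑ = ℙ∑ ℕ.+-*-semiring

private
  variable
    n : ℕ

𝕀 : Bool → Parity
𝕀 true  = 1ℙ
𝕀 false = 0ℙ

𝕀-injective : ∀ {a b} → 𝕀 a ≡ 𝕀 b → a ≡ b
𝕀-injective {true}  {true}  _ = refl
𝕀-injective {false} {false} _ = refl

δ : Fin n → Fin n → Parity
δ i u = 𝕀 (does (i ≟ u))

δ-comm : (i u : Fin n) → δ i u ≡ δ u i
δ-comm zero    zero    = refl
δ-comm zero    (suc u) = refl
δ-comm (suc i) zero    = refl
δ-comm (suc i) (suc u) = δ-comm i u

δ-≢ : {i u : Fin n} → i ≢ u → δ i u ≡ 0ℙ
δ-≢ {i = i} {u} i≢u with i ≟ u
... | yes i≡u = ⊥-elim (i≢u i≡u)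
... | no  _   = refl

∑-δ : (j : Fin n) (f : Fin n → Parity) → ∑[ u < n ] (δ j u * f u) ≡ f j
∑-δ {suc n} zero f = trans (cong (f zero +_) (sum-replicate-zero n)) (+-identityʳ (f zero))
∑-δ {suc n} (suc j) f = ∑-δ j (λ u → f (suc u))

EdgeSet : ℕ → Set
EdgeSet n = Fin n → Fin n → Parity

SymmetricEdgeSet : EdgeSet n → Set
SymmetricEdgeSet H = ∀ u v → H u v ≡ H v u

∂ : Graph n → EdgeSet n → Fin n → Parity
∂ {n} G H x = ∑[ u < n ] (𝕀 (adj G x u) * H x u)

module _ (G : Graph n) where

  ∂-+ : (H K : EdgeSet n) (x : Fin n) → ∂ G (λ u v → H u v + K u v) x ≡ ∂ G H x + ∂ G K x
  ∂-+ H K x = trans (sum-cong-≗ (λ u → *-distribˡ-+ (𝕀 (adj G x u)) (H x u) (K x u)))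
                    (∑-distrib-+ (λ u → 𝕀 (adj G x u) * H x u) (λ u → 𝕀 (adj G x u) * K x u))

  ∂-scale : (p : Fin n → Parity) (H : EdgeSet n) (x : Fin n) →
            ∂ G (λ u v → p u * H u v) x ≡ p x * ∂ G H x
  ∂-scale p H x = begin
    ∑[ u < n ] (𝕀 (adj G x u) * (p x * H x u)) ≡⟨ sum-cong-≗ (λ u → x∙yz≈y∙xz *-commutativeSemigroup (𝕀 (adj G x u)) (p x) (H x u)) ⟩
    ∑[ u < n ] (p x * (𝕀 (adj G x u) * H x u)) ≡⟨ sym (*-distribˡ-sum (p x) (λ u → 𝕀 (adj G x u) * H x u)) ⟩
    p x * ∂ G H x                              ∎
    where open ≡-Reasoning

  ∂-∑ : ∀ {m} (K : Fin m → EdgeSet n) (x : Fin n) →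
        ∂ G (λ u v → ∑[ t < m ] K t u v) x ≡ ∑[ t < m ] ∂ G (K t) x
  ∂-∑ K x = trans (sum-cong-≗ (λ u → *-distribˡ-sum (𝕀 (adj G x u)) (λ t → K t x u)))
                  (∑-comm (λ u t → 𝕀 (adj G x u) * K t x u))

  ∂-zero : (x : Fin n) → ∂ G (λ _ _ → 0ℙ) x ≡ 0ℙ
  ∂-zero x = trans (sum-cong-≗ (λ u → *-zeroʳ (𝕀 (adj G x u)))) (sum-replicate-zero n)

  ∂-δ : (j x : Fin n) → ∂ G (λ _ v → δ j v) x ≡ 𝕀 (adj G x j)
  ∂-δ j x = trans (sum-cong-≗ (λ u → *-comm (𝕀 (adj G x u)) (δ j u))) (∑-δ j (λ u → 𝕀 (adj G x u)))

  edge : Fin n → Fin n → EdgeSet n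
  edge i j u v = (δ i u * δ j v) + (δ j u * δ i v)

  edge-symmetric : (i j : Fin n) → SymmetricEdgeSet (edge i j)
  edge-symmetric i j u v =
    trans (+-comm (δ i u * δ j v) (δ j u * δ i v)) (cong₂ _+_ (*-comm (δ j u) (δ i v)) (*-comm (δ i u) (δ j v)))

  -- At x = i the factor 𝕀 (adj G i j) is 1 because ij is an edge.
  δ-absorbs-adj : {i j : Fin n} → Adj G i j → (x : Fin n) → δ i x * 𝕀 (adj G x j) ≡ δ i x
  δ-absorbs-adj {i} {j} ij x with i ≟ x
  ... | yes refl = cong 𝕀 ij
  ... | no  _    = refl

  ∂-edge : {i j : Fin n} → Adj G i j → (x : Fin n) → ∂ G (edge i j) x ≡ δ i x + δ j x
  ∂-edge {i} {j} ij x = begin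
    ∂ G (edge i j) x
      ≡⟨ ∂-+ (λ u v → δ i u * δ j v) (λ u v → δ j u * δ i v) x ⟩
    ∂ G (λ u v → δ i u * δ j v) x + ∂ G (λ u v → δ j u * δ i v) x
      ≡⟨ cong₂ _+_ (∂-scale (δ i) (λ _ → δ j) x) (∂-scale (δ j) (λ _ → δ i) x) ⟩
    (δ i x * ∂ G (λ _ → δ j) x) + (δ j x * ∂ G (λ _ → δ i) x)
      ≡⟨ cong₂ _+_ (cong (δ i x *_) (∂-δ j x)) (cong (δ j x *_) (∂-δ i x)) ⟩
    (δ i x * 𝕀 (adj G x j)) + (δ j x * 𝕀 (adj G x i))
      ≡⟨ cong₂ _+_ (δ-absorbs-adj ij x) (δ-absorbs-adj (trans (symm G j i) ij) x) ⟩
    δ i x + δ j x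
      ∎
    where open ≡-Reasoning

  walkEdges : {a b : Fin n} → Star (Adj G) a b → EdgeSet n
  walkEdges ε                 u v = 0ℙ
  walkEdges (_◅_ {i} {j} _ w) u v = edge i j u v + walkEdges w u v

  walkEdges-symmetric : {a b : Fin n} (w : Star (Adj G) a b) → SymmetricEdgeSet (walkEdges w)
  walkEdges-symmetric ε                 u v = refl
  walkEdges-symmetric (_◅_ {i} {j} _ w) u v = cong₂ _+_ (edge-symmetric i j u v) (walkEdges-symmetric w u v)

  ∂-walk : {a b : Fin n} (w : Star (Adj G) a b) (x : Fin n) → ∂ G (walkEdges w) x ≡ δ a x + δ b x
  ∂-walk {a} ε x = trans (∂-zero x) (sym (p+p≡0ℙ (δ a x)))
  ∂-walk {a} {b} (_◅_ {j = j} e w) x = begin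
    ∂ G (walkEdges (e ◅ w)) x              ≡⟨ ∂-+ (edge a j) (walkEdges w) x ⟩
    ∂ G (edge a j) x + ∂ G (walkEdges w) x ≡⟨ cong₂ _+_ (∂-edge e x) (∂-walk w x) ⟩
    (δ a x + δ j x) + (δ j x + δ b x)      ≡⟨ +-assoc (δ a x) (δ j x) _ ⟩
    δ a x + (δ j x + (δ j x + δ b x))      ≡⟨ cong (δ a x +_) (sym (+-assoc (δ j x) (δ j x) (δ b x))) ⟩
    δ a x + ((δ j x + δ j x) + δ b x)      ≡⟨ cong (λ p → δ a x + (p + δ b x)) (p+p≡0ℙ (δ j x)) ⟩
    δ a x + δ b x                          ∎
    where open ≡-Reasoning

  connected⇒boundary-realisable : Connected G → (r : Fin n) (c : Fin n → Parity) →
    Σ[ F ∈ EdgeSet n ] SymmetricEdgeSet F × (∀ x → r ≢ x → ∂ G F x ≡ c x)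
  connected⇒boundary-realisable conn r c = F , F-symmetric , ∂F
    where
    F : EdgeSet n
    F u v = ∑[ t < n ] (c t * walkEdges (conn r t) u v)

    F-symmetric : SymmetricEdgeSet F
    F-symmetric u v = sum-cong-≗ (λ t → cong (c t *_) (walkEdges-symmetric (conn r t) u v))

    ∂F : ∀ x → r ≢ x → ∂ G F x ≡ c x
    ∂F x r≢x = begin
      ∂ G F x                                   ≡⟨ ∂-∑ (λ t u v → c t * walkEdges (conn r t) u v) x ⟩
      ∑[ t < n ] ∂ G (λ u v → c t * walkEdges (conn r t) u v) x
        ≡⟨ sum-cong-≗ (λ t → trans (∂-scale (λ _ → c t) (walkEdges (conn r t)) x) (cong (c t *_) (∂-walk (conn r t) x))) ⟩
      ∑[ t < n ] (c t * (δ r x + δ t x))        ≡⟨ sum-cong-≗ (λ t → cong (λ p → c t * (p + δ t x)) (δ-≢ r≢x)) ⟩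
      ∑[ t < n ] (c t * δ t x)                  ≡⟨ sum-cong-≗ (λ t → trans (*-comm (c t) (δ t x)) (cong (_* c t) (δ-comm t x))) ⟩
      ∑[ t < n ] (δ x t * c t)                  ≡⟨ ∑-δ x c ⟩
      c x                                       ∎
      where open ≡-Reasoning

bit : Parity → ℕ
bit 0ℙ = 0
bit 1ℙ = 1

parity-bit : (p : Parity) → parity (bit p) ≡ p
parity-bit 0ℙ = refl
parity-bit 1ℙ = refl

powerLabelling : EdgeSet n → Fin n → Fin n → ℕ
powerLabelling H u v = 2 ^ bit (H u v)

powerLabelling-is2Labelling : (G : Graph n) {H : EdgeSet n} → SymmetricEdgeSet H →
                              Is2Labelling G (powerLabelling H)
powerLabelling-is2Labelling G {H} H-sym u v _ = cong (λ p → 2 ^ bit p) (H-sym u v) , one-or-two (H u v)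
  where
  one-or-two : (p : Parity) → 2 ^ bit p ≡ 1 ⊎ 2 ^ bit p ≡ 2
  one-or-two 0ℙ = inj₁ refl
  one-or-two 1ℙ = inj₂ refl

product-tabulate-^ : (b : ℕ) (e : Fin n → ℕ) → product (tabulate (λ u → b ^ e u)) ≡ b ^ ℕ∑.sum e
product-tabulate-^ {zero}  b e = refl
product-tabulate-^ {suc n} b e =
  trans (cong (b ^ e zero ℕ.*_) (product-tabulate-^ b (λ u → e (suc u))))
        (sym (ℕ.^-distribˡ-+-* b (e zero) (ℕ∑.sum (λ u → e (suc u)))))

parity-sum : (e : Fin n → ℕ) → parity (ℕ∑.sum e) ≡ ∑[ u < n ] parity (e u)
parity-sum {zero}  e = refl
parity-sum {suc n} e =
  trans (+-homo-+ (e zero) _) (cong (parity (e zero) +_) (parity-sum (λ u → e (suc u))))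

module _ (G : Graph n) (H : EdgeSet n) where

  labelExponent : Fin n → Fin n → ℕ
  labelExponent x u = if adj G x u then bit (H x u) else 0

  ρ-powerLabelling : (x : Fin n) → ρ G (powerLabelling H) x ≡ 2 ^ ℕ∑.sum (labelExponent x)
  ρ-powerLabelling x = begin
    product (map (λ u → if adj G x u then 2 ^ bit (H x u) else 1) (allFin n))
      ≡⟨ cong product (map-cong (λ u → if-^ (adj G x u)) (allFin n)) ⟩
    product (map (λ u → 2 ^ labelExponent x u) (allFin n))
      ≡⟨ cong product (map-tabulate (λ u → u) (λ u → 2 ^ labelExponent x u)) ⟩
    product (tabulate (λ u → 2 ^ labelExponent x u))
      ≡⟨ product-tabulate-^ 2 (labelExponent x) ⟩
    2 ^ ℕ∑.sum (labelExponent x) ∎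
    where
    open ≡-Reasoning
    if-^ : ∀ {k} (a : Bool) → (if a then 2 ^ k else 1) ≡ 2 ^ (if a then k else 0)
    if-^ true  = refl
    if-^ false = refl

  parity-labelExponent : (x u : Fin n) → parity (labelExponent x u) ≡ 𝕀 (adj G x u) * H x u
  parity-labelExponent x u with adj G x u
  ... | true  = parity-bit (H x u)
  ... | false = refl

  ρ-determines-∂ : (u v : Fin n) → ρ G (powerLabelling H) u ≡ ρ G (powerLabelling H) v → ∂ G H u ≡ ∂ G H v
  ρ-determines-∂ u v ρu≡ρv = begin
    ∂ G H u                                         ≡⟨ parity-∑-exponent u ⟩
    parity (ℕ∑.sum (labelExponent u))               ≡⟨ cong parity exponents-equal ⟩
    parity (ℕ∑.sum (labelExponent v))               ≡⟨ sym (parity-∑-exponent v) ⟩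
    ∂ G H v                                         ∎
    where
    open ≡-Reasoning
    parity-∑-exponent : ∀ x → ∂ G H x ≡ parity (ℕ∑.sum (labelExponent x))
    parity-∑-exponent x =
      sym (trans (parity-sum (labelExponent x)) (sum-cong-≗ (parity-labelExponent x)))

    exponents-equal : ℕ∑.sum (labelExponent u) ≡ ℕ∑.sum (labelExponent v)
    exponents-equal = begin
      ℕ∑.sum (labelExponent u)                      ≡⟨ sym (⌊log₂[2^n]⌋≡n _) ⟩
      ⌊log₂ (2 ^ ℕ∑.sum (labelExponent u)) ⌋        ≡⟨ cong ⌊log₂_⌋ (trans (sym (ρ-powerLabelling u)) (trans ρu≡ρv (ρ-powerLabelling v))) ⟩
      ⌊log₂ (2 ^ ℕ∑.sum (labelExponent v)) ⌋        ≡⟨ ⌊log₂[2^n]⌋≡n _ ⟩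
      ℕ∑.sum (labelExponent v)                      ∎

ConflictsAt : Graph n → (Fin n → Fin n → ℕ) → Fin n → Set
ConflictsAt G ℓ r = ∀ u v → Adj G u v → ρ G ℓ u ≡ ρ G ℓ v → u ≡ r ⊎ v ≡ r

∂-colouring⇒conflictsAt : (G : Graph n) (colour : Fin n → Bool) → (∀ u v → Adj G u v → colour u ≢ colour v) →
  (r : Fin n) (F : EdgeSet n) → (∀ x → r ≢ x → ∂ G F x ≡ 𝕀 (colour x)) → ConflictsAt G (powerLabelling F) r
∂-colouring⇒conflictsAt G colour proper r F ∂F u v uv ρu≡ρv with r ≟ u | r ≟ v
... | yes r≡u | _       = inj₁ (sym r≡u)
... | no _    | yes r≡v = inj₂ (sym r≡v)
... | no r≢u  | no r≢v  = ⊥-elim (proper u v uv (𝕀-injective (begin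
  𝕀 (colour u) ≡⟨ sym (∂F u r≢u) ⟩
  ∂ G F u      ≡⟨ ρ-determines-∂ G F u v ρu≡ρv ⟩
  ∂ G F v      ≡⟨ ∂F v r≢v ⟩
  𝕀 (colour v) ∎)))
  where open ≡-Reasoning

bipartite⇒labelling-conflictsAt : (G : Graph n) → Connected G → Bipartite G → (r : Fin n) →
  Σ[ ℓ ∈ (Fin n → Fin n → ℕ) ] Is2Labelling G ℓ × ConflictsAt G ℓ r
bipartite⇒labelling-conflictsAt G conn (colour , proper) r
  with connected⇒boundary-realisable G conn r (λ x → 𝕀 (colour x))
... | F , F-symmetric , ∂F =
  powerLabelling F , powerLabelling-is2Labelling G F-symmetric , ∂-colouring⇒conflictsAt G colour proper r F ∂F

module _ (G : Graph n) (ℓ : Fin n → Fin n → ℕ) {r : Fin n} (conflicts : ConflictsAt G ℓ r) where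

  conflictsAt⇒independent : (x : ℕ) → x ≢ ρ G ℓ r → Independent G (S G ℓ x)
  conflictsAt⇒independent x x≢ρr u v ρu≡x ρv≡x uv with conflicts u v uv (trans ρu≡x (sym ρv≡x))
  ... | inj₁ refl = x≢ρr (sym ρu≡x)
  ... | inj₂ refl = x≢ρr (sym ρv≡x)

  conflictsAt⇒dependent-value : (x : ℕ) → ¬ Independent G (S G ℓ x) → x ≡ ρ G ℓ r
  conflictsAt⇒dependent-value x dependent with x ℕ.≟ ρ G ℓ r
  ... | yes x≡ρr = x≡ρr
  ... | no  x≢ρr = ⊥-elim (dependent (conflictsAt⇒independent x x≢ρr))

  conflictsAt⇒star : (x : ℕ) → ¬ Independent G (S G ℓ x) → StarPlusIsolated G (S G ℓ x)
  conflictsAt⇒star x dependent =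
    r , sym (conflictsAt⇒dependent-value x dependent) ,
    λ u v ρu≡x ρv≡x uv → conflicts u v uv (trans ρu≡x (sym ρv≡x))

theorem4p3 : (n : ℕ) (G : Graph n) → Connected G → Bipartite G →
    Σ (Fin n → Fin n → ℕ) λ ℓ → Is2Labelling G ℓ ×
      ((∀ x y → ¬ Independent G (S G ℓ x) → ¬ Independent G (S G ℓ y) → x ≡ y) ×
       (∀ x → ¬ Independent G (S G ℓ x) → StarPlusIsolated G (S G ℓ x)))
theorem4p3 zero G _ _ =
  (λ _ _ → 1) , (λ ()) , (λ _ _ dependent _ → ⊥-elim (dependent λ ())) , (λ _ dependent → ⊥-elim (dependent λ ()))
theorem4p3 (suc n) G conn bipartite with bipartite⇒labelling-conflictsAt G conn bipartite zero
... | ℓ , is2Labelling , conflicts =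
  ℓ , is2Labelling ,
  (λ x y x-dependent y-dependent → trans (conflictsAt⇒dependent-value G ℓ conflicts x x-dependent)
                                        (sym (conflictsAt⇒dependent-value G ℓ conflicts y y-dependent))) ,
  conflictsAt⇒star G ℓ conflicts
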